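{- For every prime $n\in C_2$, there exists a cardioidal starter of order $n$.
   Context: $C_2$ is the set of (odd) primes $p$ such that the multiplicative order of $2$ modulo $p$ is $\equiv2\pmod4$. A starter in $\mathbb{Z}_n$ ($n$ odd) is a partition of $\mathbb{Z}_n\setminus\{0\}$ into $(n-1)/2$ pairs $\{s_i,t_i\}$ such that the elements $\pm(s_i-t_i)$ are exactly the non-zero elements of $\mathbb{Z}_n$. A starter is cardioidal if every pair has the form $\{i,2i\bmod n\}$ for some $i\in\mathbb{Z}_n\setminus\{0\}$. -}

module Defs where

open import Data.Nat using (ℕ; zero; suc; _+_; _*_; _∸_; _^_; _≤_; _<_)
open import Data.Nat.DivMod using (_%_)
open import Data.Nat.Primality using (Prime)
open import Data.List using (List; []; _∷_; map; upTo; concatMap)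
open import Data.List.Relation.Binary.Permutation.Propositional using (_↭_)
open import Data.List.Relation.Unary.All using (All)
open import Data.Product using (_×_; _,_; ∃; ∃-syntax)
open import Data.Sum using (_⊎_)
open import Relation.Binary.PropositionalEquality using (_≡_; _≢_)
open import Relation.Nullary using (¬_)

-- reduction modulo n (elements of ℤ_n are represented by naturals 0..n-1)
modN : ℕ → ℕ → ℕ
modN zero    x = x
modN (suc k) x = x % suc k

-- subtraction in ℤ_n, for a, b < n
subN : ℕ → ℕ → ℕ → ℕ
subN n a b = modN n (a + (n ∸ b))

IsOrd2 : ℕ → ℕ → Set
IsOrd2 p k = 1 ≤ k × modN p (2 ^ k) ≡ 1 × (∀ j → 1 ≤ j → j < k → modN p (2 ^ j) ≢ 1)

C₂ : ℕ → Set
C₂ p = Prime p × p ≢ 2 × ∃[ k ] (IsOrd2 p k × k % 4 ≡ 2)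

nonzero : ℕ → List ℕ
nonzero n = map suc (upTo (n ∸ 1))

Pair : Set
Pair = ℕ × ℕ

elems : Pair → List ℕ
elems (s , t) = s ∷ t ∷ []

diffs : ℕ → Pair → List ℕ
diffs n (s , t) = subN n s t ∷ subN n t s ∷ []

-- a list of (unordered) pairs {s,t} is a starter in ℤ_n:
-- the pairs partition ℤ_n ∖ {0}, and the elements ±(s - t) are exactly
-- the non-zero elements of ℤ_n
IsStarter : ℕ → List Pair → Set
IsStarter n ps = (concatMap elems ps ↭ nonzero n) × (concatMap (diffs n) ps ↭ nonzero n)

CardioidalPair : ℕ → Pair → Set
CardioidalPair n (s , t) =
  ∃[ i ] (1 ≤ i × i < n × ((s ≡ i × t ≡ modN n (2 * i)) ⊎ (s ≡ modN n (2 * i) × t ≡ i)))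

IsCardioidalStarter : ℕ → List Pair → Set
IsCardioidalStarter n ps = IsStarter n ps × All (CardioidalPair n) ps

-- Let k = m + m, with m odd, be the order of 2 modulo p. Doubling permutes the non-zero
-- residues in cycles of even length k, so the parity of the number of doublings that lead
-- from x to the least element of its cycle is well defined; call it the colour of x.
-- Multiplying by 2^t changes the colour by the parity of t, so doubling, and multiplication
-- by 2^m ≡ -1 (the square root of 1 mod p other than 1), swap the two colour classes I and J.
-- The pairs {i, 2i} for i ∈ I therefore cover I ∪ 2I = I ∪ J, and their differences ±i
-- cover I ∪ (-I) = I ∪ J.
module Submission where

open import Defs
open import Data.List using (List; []; _∷_; map; _++_; concat; concatMap; filter; upTo)
open import Data.List.Extrema.Nat using (argmin; f[argmin]≤f[xs])
open import Data.List.Membership.Propositional using (_∈_)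
open import Data.List.Membership.Propositional.Properties
  using (∈-map⁺; ∈-map⁻; ∈-upTo⁺; ∈-upTo⁻; ∈-filter⁺; ∈-filter⁻)
open import Data.List.Membership.Propositional.Properties.WithK using (unique∧set⇒bag)
open import Data.List.Properties using (map-∘; map-id; map-id-local; map-cong; map-cong-local)
open import Data.List.Relation.Binary.BagAndSetEquality using (∼bag⇒↭)
open import Data.List.Relation.Binary.Permutation.Propositional
  using (_↭_; ↭-refl; ↭-trans; ↭-sym; prep; module PermutationReasoning)
open import Data.List.Relation.Binary.Permutation.Propositional.Properties
  using (shift; ++⁺ˡ; ++⁺ʳ; ++-comm)
open import Data.List.Relation.Unary.All as All using (All)
import Data.List.Relation.Unary.All.Properties as All
open import Data.List.Relation.Unary.Unique.Propositional using (Unique)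
import Data.List.Relation.Unary.Unique.Propositional.Properties as Unique
open import Data.Nat
open import Data.Nat.Divisibility
open import Data.Nat.DivMod
open import Data.Nat.Primality using (Prime; euclidsLemma; prime⇒nonZero; prime⇒nonTrivial; ¬prime[1])
open import Data.Nat.Properties
open import Data.Nat.Tactic.RingSolver using (solve-∀)
open import Data.Parity.Base as ℙ using (Parity; 0ℙ; 1ℙ)
import Data.Parity.Properties as ℙ
open import Data.Product using (∃-syntax; _×_; _,_; proj₁; proj₂)
open import Data.Sum as Sum using (_⊎_; inj₁; inj₂; [_,_]′)
open import Function using (id; _∘_)
open import Function.Bundles using (mk⇔)
open import Relation.Nullary using (contradiction)
open import Relation.Binary.PropositionalEquality

↭-filter-parity : ∀ {A : Set} (f : A → Parity) (xs : List A) →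
  xs ↭ filter (λ x → f x ℙ.≟ 0ℙ) xs ++ filter (λ x → f x ℙ.≟ 1ℙ) xs
↭-filter-parity f [] = ↭-refl
↭-filter-parity f (x ∷ xs) with f x
... | 0ℙ = prep x (↭-filter-parity f xs)
... | 1ℙ = ↭-trans (prep x (↭-filter-parity f xs)) (↭-sym (shift x _ _))

concatMap-pair-↭ : ∀ {A B : Set} (f g : A → B) (xs : List A) →
  concatMap (λ x → f x ∷ g x ∷ []) xs ↭ map f xs ++ map g xs
concatMap-pair-↭ f g [] = ↭-refl
concatMap-pair-↭ f g (x ∷ xs) =
  prep (f x) (↭-trans (prep (g x) (concatMap-pair-↭ f g xs))
                      (↭-sym (shift (g x) (map f xs) (map g xs))))

inverseOn⇒map-↭ : ∀ {A : Set} {f g : A → A} {xs ys : List A} → Unique xs → Unique ys →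
  (∀ {x} → x ∈ xs → f x ∈ ys) → (∀ {y} → y ∈ ys → g y ∈ xs) →
  (∀ {x} → x ∈ xs → g (f x) ≡ x) → (∀ {y} → y ∈ ys → f (g y) ≡ y) →
  map f xs ↭ ys
inverseOn⇒map-↭ {f = f} {g} {xs} {ys} xs! ys! f∈ g∈ gf≡ fg≡ =
  ∼bag⇒↭ (unique∧set⇒bag fxs! ys! (mk⇔ to from))
  where
  g[f[xs]]≡xs : map g (map f xs) ≡ xs
  g[f[xs]]≡xs = trans (sym (map-∘ {g = g} {f} xs)) (map-id-local (All.tabulate gf≡))
  fxs! : Unique (map f xs)
  fxs! = Unique.map⁻ {f = g} (subst Unique (sym g[f[xs]]≡xs) xs!)
  to : ∀ {z} → z ∈ map f xs → z ∈ ys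
  to z∈ with ∈-map⁻ f z∈
  ... | x , x∈ , refl = f∈ x∈
  from : ∀ {y} → y ∈ ys → y ∈ map f xs
  from y∈ = subst (_∈ map f xs) (fg≡ y∈) (∈-map⁺ f (g∈ y∈))

∈-nonzero⁻ : ∀ {n x} → x ∈ nonzero n → 1 ≤ x × x < n
∈-nonzero⁻ {suc n} x∈ with ∈-map⁻ suc x∈
... | w , w∈ , refl = s≤s z≤n , s≤s (∈-upTo⁻ w∈)

∈-nonzero⁺ : ∀ {n x} → 1 ≤ x → x < n → x ∈ nonzero n
∈-nonzero⁺ {suc n} {suc w} _ (s≤s w<n) = ∈-map⁺ suc (∈-upTo⁺ w<n)

nonzero! : ∀ n → Unique (nonzero n)
nonzero! n = Unique.map⁺ suc-injective (Unique.upTo⁺ (n ∸ 1))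

modN≡% : ∀ n .{{_ : NonZero n}} x → modN n x ≡ x % n
modN≡% (suc n) x = refl

module _ (n : ℕ) .{{_ : NonZero n}} where

  [m%n*o]%n≡[m*o]%n : ∀ m o → (m % n * o) % n ≡ (m * o) % n
  [m%n*o]%n≡[m*o]%n m o = begin
    (m % n * o) % n           ≡⟨ %-distribˡ-* (m % n) o n ⟩
    (m % n % n * (o % n)) % n ≡⟨ cong (λ x → (x * (o % n)) % n) (m%n%n≡m%n m n) ⟩
    (m % n * (o % n)) % n     ≡⟨ %-distribˡ-* m o n ⟨
    (m * o) % n               ∎
    where open ≡-Reasoning

  [m*[o%n]]%n≡[m*o]%n : ∀ m o → (m * (o % n)) % n ≡ (m * o) % n
  [m*[o%n]]%n≡[m*o]%n m o = begin
    (m * (o % n)) % n ≡⟨ cong (_% n) (*-comm m (o % n)) ⟩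
    (o % n * m) % n   ≡⟨ [m%n*o]%n≡[m*o]%n o m ⟩
    (o * m) % n       ≡⟨ cong (_% n) (*-comm o m) ⟩
    (m * o) % n       ∎
    where open ≡-Reasoning

  [m+[o%n]]%n≡[m+o]%n : ∀ m o → (m + o % n) % n ≡ (m + o) % n
  [m+[o%n]]%n≡[m+o]%n m o = begin
    (m + o % n) % n           ≡⟨ %-distribˡ-+ m (o % n) n ⟩
    (m % n + o % n % n) % n   ≡⟨ cong (λ x → (m % n + x) % n) (m%n%n≡m%n o n) ⟩
    (m % n + o % n) % n       ≡⟨ %-distribˡ-+ m o n ⟨
    (m + o) % n               ∎
    where open ≡-Reasoning

  %≡%⇒∣∸ : ∀ a b → a % n ≡ b % n → n ∣ b ∸ a
  %≡%⇒∣∸ a b a≡b = divides (b / n ∸ a / n) (begin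
    b ∸ a
      ≡⟨ cong₂ _∸_ (m≡m%n+[m/n]*n b n) (m≡m%n+[m/n]*n a n) ⟩
    (b % n + b / n * n) ∸ (a % n + a / n * n)
      ≡⟨ cong (λ x → (x + b / n * n) ∸ (a % n + a / n * n)) a≡b ⟨
    (a % n + b / n * n) ∸ (a % n + a / n * n)
      ≡⟨ [m+n]∸[m+o]≡n∸o (a % n) _ _ ⟩
    b / n * n ∸ a / n * n
      ≡⟨ *-distribʳ-∸ n (b / n) (a / n) ⟨
    (b / n ∸ a / n) * n
      ∎)
    where open ≡-Reasoning

  ∣∸⇒%≡% : ∀ {a b} → a ≤ b → n ∣ b ∸ a → a % n ≡ b % n
  ∣∸⇒%≡% {a} {b} a≤b n∣b∸a = begin
    a % n             ≡⟨ %-remove-+ʳ a n∣b∸a ⟨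
    (a + (b ∸ a)) % n ≡⟨ cong (_% n) (m+[n∸m]≡n a≤b) ⟩
    b % n             ∎
    where open ≡-Reasoning

  %-cancelˡ-+ : ∀ c a b → (c + a) % n ≡ (c + b) % n → a % n ≡ b % n
  %-cancelˡ-+ c a b c+a≡c+b with ≤-total a b
  ... | inj₁ a≤b = ∣∸⇒%≡% a≤b
    (subst (n ∣_) ([m+n]∸[m+o]≡n∸o c b a) (%≡%⇒∣∸ _ _ c+a≡c+b))
  ... | inj₂ b≤a = sym (∣∸⇒%≡% b≤a
    (subst (n ∣_) ([m+n]∸[m+o]≡n∸o c a b) (%≡%⇒∣∸ _ _ (sym c+a≡c+b))))

  [m*pred[n]]%n≡n∸m : ∀ {m} → 1 ≤ m → m ≤ n → (m * pred n) % n ≡ n ∸ m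
  [m*pred[n]]%n≡n∸m {m} 1≤m m≤n = begin
    (m * pred n) % n ≡⟨ %-cancelˡ-+ m _ _ (trans m+m*pred[n]≡0 (sym m+[n∸m]≡0)) ⟩
    (n ∸ m) % n      ≡⟨ m<n⇒m%n≡m (∸-monoʳ-< 1≤m m≤n) ⟩
    n ∸ m            ∎
    where
    open ≡-Reasoning
    m+m*pred[n]≡0 : (m + m * pred n) % n ≡ 0
    m+m*pred[n]≡0 = begin
      (m + m * pred n) % n ≡⟨ cong (_% n) (*-suc m (pred n)) ⟨
      (m * suc (pred n)) % n ≡⟨ cong (λ x → (m * x) % n) (suc-pred n) ⟩
      (m * n) % n ≡⟨ m*n%n≡0 m n ⟩
      0 ∎
    m+[n∸m]≡0 : (m + (n ∸ m)) % n ≡ 0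
    m+[n∸m]≡0 = trans (cong (_% n) (m+[n∸m]≡n m≤n)) (n%n≡0 n)

  subN-+ : ∀ a {b} → b ≤ n → (b + subN n a b) % n ≡ a % n
  subN-+ a {b} b≤n = begin
    (b + subN n a b) % n            ≡⟨ cong (λ x → (b + x) % n) (modN≡% n _) ⟩
    (b + (a + (n ∸ b)) % n) % n     ≡⟨ [m+[o%n]]%n≡[m+o]%n b (a + (n ∸ b)) ⟩
    (b + (a + (n ∸ b))) % n         ≡⟨ cong (_% n) (+-comm b (a + (n ∸ b))) ⟩
    (a + (n ∸ b) + b) % n           ≡⟨ cong (_% n) (+-assoc a (n ∸ b) b) ⟩
    (a + (n ∸ b + b)) % n           ≡⟨ cong (λ x → (a + x) % n) (m∸n+n≡m b≤n) ⟩
    (a + n) % n                     ≡⟨ [m+n]%n≡m%n a n ⟩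
    a % n                           ∎
    where open ≡-Reasoning

  subN-unique : ∀ {a b c} → b ≤ n → c < n → (b + c) % n ≡ a % n → subN n a b ≡ c
  subN-unique {a} {b} {c} b≤n c<n b+c≡a = begin
    subN n a b     ≡⟨ m<n⇒m%n≡m subN<n ⟨
    subN n a b % n ≡⟨ %-cancelˡ-+ b (subN n a b) c (trans (subN-+ a b≤n) (sym b+c≡a)) ⟩
    c % n          ≡⟨ m<n⇒m%n≡m c<n ⟩
    c              ∎
    where
    open ≡-Reasoning
    subN<n : subN n a b < n
    subN<n = subst (_< n) (sym (modN≡% n _)) (m%n<n _ n)

  subN[m,2m]≡n∸m : ∀ {m} → 1 ≤ m → m < n → subN n m (modN n (2 * m)) ≡ n ∸ m
  subN[m,2m]≡n∸m {m} 1≤m m<n = subN-unique (<⇒≤ 2m%n<n) (∸-monoʳ-< 1≤m (<⇒≤ m<n)) (begin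
    (modN n (2 * m) + (n ∸ m)) % n  ≡⟨ cong (_% n) (+-comm (modN n (2 * m)) (n ∸ m)) ⟩
    (n ∸ m + modN n (2 * m)) % n    ≡⟨ cong (λ x → (n ∸ m + x) % n) (modN≡% n _) ⟩
    (n ∸ m + (2 * m) % n) % n       ≡⟨ [m+[o%n]]%n≡[m+o]%n (n ∸ m) (2 * m) ⟩
    (n ∸ m + (m + (m + 0))) % n     ≡⟨ cong (_% n) (+-assoc (n ∸ m) m (m + 0)) ⟨
    (n ∸ m + m + (m + 0)) % n       ≡⟨ cong (λ x → (x + (m + 0)) % n) (m∸n+n≡m (<⇒≤ m<n)) ⟩
    (n + (m + 0)) % n               ≡⟨ %-remove-+ˡ (m + 0) ∣-refl ⟩
    (m + 0) % n                     ≡⟨ cong (_% n) (+-identityʳ m) ⟩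
    m % n                           ∎)
    where
    open ≡-Reasoning
    2m%n<n : modN n (2 * m) < n
    2m%n<n = subst (_< n) (sym (modN≡% n _)) (m%n<n _ n)

  subN[2m,m]≡m : ∀ {m} → m < n → subN n (modN n (2 * m)) m ≡ m
  subN[2m,m]≡m {m} m<n = subN-unique (<⇒≤ m<n) m<n (begin
    (m + m) % n           ≡⟨ cong (λ x → (m + x) % n) (+-identityʳ m) ⟨
    (2 * m) % n           ≡⟨ m%n%n≡m%n (2 * m) n ⟨
    (2 * m) % n % n       ≡⟨ cong (_% n) (modN≡% n _) ⟨
    modN n (2 * m) % n    ∎)
    where open ≡-Reasoning

module _ {p : ℕ} (p-prime : Prime p) where

  private instance
    p-nonZero : NonZero p
    p-nonZero = prime⇒nonZero p-prime

  prime⇒1<p : 1 < p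
  prime⇒1<p = nonTrivial⇒n>1 p {{prime⇒nonTrivial p-prime}}

  prime∤* : ∀ {m n} → p ∤ m → p ∤ n → p ∤ m * n
  prime∤* p∤m p∤n p∣m*n with euclidsLemma _ _ p-prime p∣m*n
  ... | inj₁ p∣m = p∤m p∣m
  ... | inj₂ p∣n = p∤n p∣n

  prime∤^ : ∀ {m} → p ∤ m → ∀ t → p ∤ m ^ t
  prime∤^ p∤m zero    p∣1 = ¬prime[1] (subst Prime (∣1⇒≡1 p∣1) p-prime)
  prime∤^ p∤m (suc t) = prime∤* p∤m (prime∤^ p∤m t)

  prime≢2⇒∤2 : p ≢ 2 → p ∤ 2
  prime≢2⇒∤2 p≢2 p∣2 = p≢2 (≤-antisym (∣⇒≤ p∣2) prime⇒1<p)

  *-cancelˡ-% : ∀ {y a b} → p ∤ y → a ≤ b → (y * a) % p ≡ (y * b) % p → a % p ≡ b % p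
  *-cancelˡ-% {y} {a} {b} p∤y a≤b ya≡yb =
    [ (λ p∣y → contradiction p∣y p∤y) , ∣∸⇒%≡% p a≤b ]′ (euclidsLemma y (b ∸ a) p-prime p∣y[b∸a])
    where
    p∣y[b∸a] : p ∣ y * (b ∸ a)
    p∣y[b∸a] = subst (p ∣_) (sym (*-distribˡ-∸ y b a)) (%≡%⇒∣∸ p _ _ ya≡yb)

  a*a%p≡1⇒a≡1⊎a≡pred[p] : ∀ {a} → a < p → (a * a) % p ≡ 1 → a ≡ 1 ⊎ a ≡ pred p
  a*a%p≡1⇒a≡1⊎a≡pred[p] {zero} 0<p 0≡1 = contradiction (trans (sym (m<n⇒m%n≡m 0<p)) 0≡1) λ ()
  a*a%p≡1⇒a≡1⊎a≡pred[p] {suc b} b+1<p a*a≡1 =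
    Sum.map (cong suc ∘ b≡0) (λ p∣b+2 → cong pred (≤-antisym b+1<p (∣⇒≤ p∣b+2)))
      (euclidsLemma b (suc (suc b)) p-prime p∣b[b+2])
    where
    p∣b[b+2] : p ∣ b * suc (suc b)
    p∣b[b+2] = subst (p ∣_) (sym (*-suc b (suc b)))
      (%≡%⇒∣∸ p 1 (suc b * suc b) (trans (m<n⇒m%n≡m prime⇒1<p) (sym a*a≡1)))
    b≡0 : p ∣ b → b ≡ 0
    b≡0 p∣b = trans (sym (m<n⇒m%n≡m (<-trans (n<1+n b) b+1<p))) (n∣m⇒m%n≡0 b p p∣b)

parity[m]≡parity[m%n] : ∀ m n .{{_ : NonZero n}} → parity n ≡ 0ℙ → parity m ≡ parity (m % n)
parity[m]≡parity[m%n] m n n-even = begin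
  parity m                              ≡⟨ cong parity (m≡m%n+[m/n]*n m n) ⟩
  parity (m % n + m / n * n)            ≡⟨ ℙ.+-homo-+ (m % n) (m / n * n) ⟩
  parity (m % n) ℙ.+ parity (m / n * n) ≡⟨ cong (parity (m % n) ℙ.+_) parity[m/n*n]≡0ℙ ⟩
  parity (m % n) ℙ.+ 0ℙ                 ≡⟨ ℙ.+-identityʳ (parity (m % n)) ⟩
  parity (m % n)                        ∎
  where
  open ≡-Reasoning
  parity[m/n*n]≡0ℙ : parity (m / n * n) ≡ 0ℙ
  parity[m/n*n]≡0ℙ = begin
    parity (m / n * n)             ≡⟨ ℙ.*-homo-* (m / n) n ⟩
    parity (m / n) ℙ.* parity n    ≡⟨ cong (parity (m / n) ℙ.*_) n-even ⟩
    parity (m / n) ℙ.* 0ℙ          ≡⟨ ℙ.*-zeroʳ (parity (m / n)) ⟩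
    0ℙ                             ∎

m%4≡2⇒twice-odd : ∀ {k} → k % 4 ≡ 2 → ∃[ m ] k ≡ m + m × parity m ≡ 1ℙ
m%4≡2⇒twice-odd {k} k%4≡2 = suc (r + r) , k≡m+m , m-odd
  where
  r = k / 4
  [2+r*4]≡[1+2r]+[1+2r] : ∀ r → 2 + r * 4 ≡ suc (r + r) + suc (r + r)
  [2+r*4]≡[1+2r]+[1+2r] = solve-∀
  k≡m+m : k ≡ suc (r + r) + suc (r + r)
  k≡m+m = trans (m≡m%n+[m/n]*n k 4) (trans (cong (_+ r * 4) k%4≡2) ([2+r*4]≡[1+2r]+[1+2r] r))
  m-odd : parity (suc (r + r)) ≡ 1ℙ
  m-odd = trans (sym (ℙ.⁻¹-selfInverse (ℙ.suc-homo-⁻¹ (r + r))))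
                (cong ℙ._⁻¹ (trans (ℙ.+-homo-+ r r) (ℙ.p+p≡0ℙ (parity r))))

module Doubling {p : ℕ} (p-prime : Prime p) (p≢2 : p ≢ 2) {k : ℕ} (k-ord : IsOrd2 p k) where

  instance
    p-nonZero : NonZero p
    p-nonZero = prime⇒nonZero p-prime
    k-nonZero : NonZero k
    k-nonZero = >-nonZero (proj₁ k-ord)

  2^k%p≡1 : 2 ^ k % p ≡ 1
  2^k%p≡1 = trans (sym (modN≡% p _)) (proj₁ (proj₂ k-ord))

  2^j%p≢1 : ∀ j → 1 ≤ j → j < k → 2 ^ j % p ≢ 1
  2^j%p≢1 j 1≤j j<k = proj₂ (proj₂ k-ord) j 1≤j j<k ∘ trans (modN≡% p _)

  infixl 7 _·2^_
  _·2^_ : ℕ → ℕ → ℕ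
  x ·2^ t = (x * 2 ^ t) % p

  ·2^-< : ∀ x t → x ·2^ t < p
  ·2^-< x t = m%n<n (x * 2 ^ t) p

  ·2^-+ : ∀ x s t → x ·2^ s ·2^ t ≡ x ·2^ (s + t)
  ·2^-+ x s t = begin
    (x * 2 ^ s) % p * 2 ^ t % p ≡⟨ [m%n*o]%n≡[m*o]%n p (x * 2 ^ s) (2 ^ t) ⟩
    x * 2 ^ s * 2 ^ t % p       ≡⟨ cong (_% p) (*-assoc x (2 ^ s) (2 ^ t)) ⟩
    x * (2 ^ s * 2 ^ t) % p     ≡⟨ cong (λ y → x * y % p) (^-distribˡ-+-* 2 s t) ⟨
    x * 2 ^ (s + t) % p         ∎
    where open ≡-Reasoning

  p∤x*2^t : ∀ {x} t → 1 ≤ x → x < p → p ∤ x * 2 ^ t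
  p∤x*2^t t 1≤x x<p =
    prime∤* p-prime (>⇒∤ {{>-nonZero 1≤x}} x<p) (prime∤^ p-prime (prime≢2⇒∤2 p-prime p≢2) t)

  ·2^-positive : ∀ {x} t → 1 ≤ x → x < p → 1 ≤ x ·2^ t
  ·2^-positive {x} t 1≤x x<p with x ·2^ t in eq
  ... | zero  = contradiction (m%n≡0⇒n∣m _ p eq) (p∤x*2^t t 1≤x x<p)
  ... | suc _ = s≤s z≤n

  ·2^-period : ∀ {y} c → y < p → y ·2^ (c * k) ≡ y
  ·2^-period {y} zero    y<p = trans (cong (_% p) (*-identityʳ y)) (m<n⇒m%n≡m y<p)
  ·2^-period {y} (suc c) y<p = begin
    y ·2^ (k + c * k)   ≡⟨ ·2^-+ y k (c * k) ⟨
    y ·2^ k ·2^ (c * k) ≡⟨ cong (_·2^ (c * k)) y·2^k≡y ⟩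
    y ·2^ (c * k)       ≡⟨ ·2^-period c y<p ⟩
    y                   ∎
    where
    open ≡-Reasoning
    y·2^k≡y : y ·2^ k ≡ y
    y·2^k≡y = begin
      y * 2 ^ k % p         ≡⟨ [m*[o%n]]%n≡[m*o]%n p y (2 ^ k) ⟨
      y * (2 ^ k % p) % p   ≡⟨ cong (λ z → y * z % p) 2^k%p≡1 ⟩
      y * 1 % p             ≡⟨ ·2^-period zero y<p ⟩
      y                     ∎

  ·2^-% : ∀ x t → x ·2^ t ≡ x ·2^ (t % k)
  ·2^-% x t = begin
    x ·2^ t                          ≡⟨ cong (x ·2^_) (m≡m%n+[m/n]*n t k) ⟩
    x ·2^ (t % k + t / k * k)        ≡⟨ ·2^-+ x (t % k) (t / k * k) ⟨
    x ·2^ (t % k) ·2^ (t / k * k)    ≡⟨ ·2^-period (t / k) (·2^-< x (t % k)) ⟩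
    x ·2^ (t % k)                    ∎
    where open ≡-Reasoning

  ·2^-inverseʳ : ∀ {y} s → y < p → y ·2^ s ·2^ (s * pred k) ≡ y
  ·2^-inverseʳ {y} s y<p = begin
    y ·2^ s ·2^ (s * pred k) ≡⟨ ·2^-+ y s (s * pred k) ⟩
    y ·2^ (s + s * pred k)   ≡⟨ cong (y ·2^_) (*-suc s (pred k)) ⟨
    y ·2^ (s * suc (pred k)) ≡⟨ cong (λ t → y ·2^ (s * t)) (suc-pred k) ⟩
    y ·2^ (s * k)            ≡⟨ ·2^-period s y<p ⟩
    y                        ∎
    where open ≡-Reasoning

  ·2^-inverseˡ : ∀ {y} s → y < p → y ·2^ (s * pred k) ·2^ s ≡ y
  ·2^-inverseˡ {y} s y<p = begin
    y ·2^ (s * pred k) ·2^ s ≡⟨ ·2^-+ y (s * pred k) s ⟩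
    y ·2^ (s * pred k + s)   ≡⟨ cong (y ·2^_) (+-comm (s * pred k) s) ⟩
    y ·2^ (s + s * pred k)   ≡⟨ ·2^-+ y s (s * pred k) ⟨
    y ·2^ s ·2^ (s * pred k) ≡⟨ ·2^-inverseʳ s y<p ⟩
    y                        ∎
    where open ≡-Reasoning

  2^d%p≡1⇒k∣d : ∀ d → 2 ^ d % p ≡ 1 → k ∣ d
  2^d%p≡1⇒k∣d d 2^d≡1 with d % k in d%k≡r
  ... | zero  = m%n≡0⇒n∣m d k d%k≡r
  ... | suc r = contradiction 2^[1+r]≡1 (2^j%p≢1 (suc r) z<s (subst (_< k) d%k≡r (m%n<n d k)))
    where
    open ≡-Reasoning
    2^[1+r]≡1 : 2 ^ suc r % p ≡ 1
    2^[1+r]≡1 = begin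
      2 ^ suc r % p   ≡⟨ cong (_% p) (*-identityˡ (2 ^ suc r)) ⟨
      1 ·2^ suc r     ≡⟨ cong (1 ·2^_) d%k≡r ⟨
      1 ·2^ (d % k)   ≡⟨ ·2^-% 1 d ⟨
      1 ·2^ d         ≡⟨ cong (_% p) (*-identityˡ (2 ^ d)) ⟩
      2 ^ d % p       ≡⟨ 2^d≡1 ⟩
      1               ∎

  ·2^-cancel-≤ : ∀ {x a b} → 1 ≤ x → x < p → a ≤ b → x ·2^ a ≡ x ·2^ b → a % k ≡ b % k
  ·2^-cancel-≤ {x} {a} {b} 1≤x x<p a≤b x·2^a≡x·2^b =
    ∣∸⇒%≡% k a≤b (2^d%p≡1⇒k∣d d (trans (sym 1≡2^d) (m<n⇒m%n≡m (prime⇒1<p p-prime))))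
    where
    open ≡-Reasoning
    d = b ∸ a
    1≡2^d : 1 % p ≡ 2 ^ d % p
    1≡2^d = *-cancelˡ-% p-prime (p∤x*2^t a 1≤x x<p) (m^n>0 2 d) (begin
      x * 2 ^ a * 1 % p       ≡⟨ cong (_% p) (*-identityʳ (x * 2 ^ a)) ⟩
      x ·2^ a                 ≡⟨ x·2^a≡x·2^b ⟩
      x ·2^ b                 ≡⟨ cong (x ·2^_) (m+[n∸m]≡n a≤b) ⟨
      x ·2^ (a + d)           ≡⟨ cong (λ z → x * z % p) (^-distribˡ-+-* 2 a d) ⟩
      x * (2 ^ a * 2 ^ d) % p ≡⟨ cong (_% p) (*-assoc x (2 ^ a) (2 ^ d)) ⟨
      x * 2 ^ a * 2 ^ d % p   ∎)

  ·2^-cancel : ∀ {x a b} → 1 ≤ x → x < p → x ·2^ a ≡ x ·2^ b → a % k ≡ b % k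
  ·2^-cancel {a = a} {b} 1≤x x<p x·2^a≡x·2^b with ≤-total a b
  ... | inj₁ a≤b = ·2^-cancel-≤ 1≤x x<p a≤b x·2^a≡x·2^b
  ... | inj₂ b≤a = sym (·2^-cancel-≤ 1≤x x<p b≤a (sym x·2^a≡x·2^b))

  stepsToMin : ℕ → ℕ
  stepsToMin x = argmin (x ·2^_) 0 (upTo k)

  orbitMin : ℕ → ℕ
  orbitMin x = x ·2^ stepsToMin x

  orbitMin-≤ : ∀ x t → orbitMin x ≤ x ·2^ t
  orbitMin-≤ x t = subst (orbitMin x ≤_) (sym (·2^-% x t))
    (All.lookup (f[argmin]≤f[xs] {f = x ·2^_} 0 (upTo k)) (∈-upTo⁺ (m%n<n t k)))

  orbitMin-·2^ : ∀ {y} s → y < p → orbitMin (y ·2^ s) ≡ orbitMin y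
  orbitMin-·2^ {y} s y<p = ≤-antisym
    (subst (orbitMin (y ·2^ s) ≤_) y·2^s·2^[s*pred[k]+τ]≡y·2^τ
      (orbitMin-≤ (y ·2^ s) (s * pred k + τ)))
    (subst (orbitMin y ≤_) (sym (·2^-+ y s τ′)) (orbitMin-≤ y (s + τ′)))
    where
    open ≡-Reasoning
    τ = stepsToMin y
    τ′ = stepsToMin (y ·2^ s)
    y·2^s·2^[s*pred[k]+τ]≡y·2^τ : y ·2^ s ·2^ (s * pred k + τ) ≡ y ·2^ τ
    y·2^s·2^[s*pred[k]+τ]≡y·2^τ = begin
      y ·2^ s ·2^ (s * pred k + τ)   ≡⟨ ·2^-+ (y ·2^ s) (s * pred k) τ ⟨
      y ·2^ s ·2^ (s * pred k) ·2^ τ ≡⟨ cong (_·2^ τ) (·2^-inverseʳ s y<p) ⟩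
      y ·2^ τ                        ∎

  colour : ℕ → Parity
  colour x = parity (stepsToMin x)

  colour-·2^ : parity k ≡ 0ℙ → ∀ {x} s → 1 ≤ x → x < p →
               parity s ℙ.+ colour (x ·2^ s) ≡ colour x
  colour-·2^ k-even {x} s 1≤x x<p = begin
    parity s ℙ.+ colour (x ·2^ s) ≡⟨ ℙ.+-homo-+ s τ′ ⟨
    parity (s + τ′)               ≡⟨ parity[m]≡parity[m%n] (s + τ′) k k-even ⟩
    parity ((s + τ′) % k)         ≡⟨ cong parity (·2^-cancel 1≤x x<p same-min) ⟩
    parity (stepsToMin x % k)     ≡⟨ parity[m]≡parity[m%n] (stepsToMin x) k k-even ⟨
    colour x                      ∎
    where
    open ≡-Reasoning
    τ′ = stepsToMin (x ·2^ s)
    same-min : x ·2^ (s + τ′) ≡ orbitMin x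
    same-min = trans (sym (·2^-+ x s τ′)) (orbitMin-·2^ s x<p)

  2^m%p≡pred[p] : ∀ m → k ≡ m + m → 2 ^ m % p ≡ pred p
  2^m%p≡pred[p] m k≡m+m =
    [ (λ 2^m%p≡1 → contradiction 2^m%p≡1 (2^j%p≢1 m 1≤m m<k)) , id ]′
      (a*a%p≡1⇒a≡1⊎a≡pred[p] p-prime (m%n<n (2 ^ m) p) square≡1)
    where
    open ≡-Reasoning
    1≤m : 1 ≤ m
    1≤m = n≢0⇒n>0 (λ m≡0 → ≢-nonZero⁻¹ k (trans k≡m+m (cong₂ _+_ m≡0 m≡0)))
    m<k : m < k
    m<k = subst (m <_) (sym k≡m+m) (m<m+n m 1≤m)
    square≡1 : 2 ^ m % p * (2 ^ m % p) % p ≡ 1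
    square≡1 = begin
      2 ^ m % p * (2 ^ m % p) % p ≡⟨ %-distribˡ-* (2 ^ m) (2 ^ m) p ⟨
      2 ^ m * 2 ^ m % p           ≡⟨ cong (_% p) (^-distribˡ-+-* 2 m m) ⟨
      2 ^ (m + m) % p             ≡⟨ cong (λ t → 2 ^ t % p) k≡m+m ⟨
      2 ^ k % p                   ≡⟨ 2^k%p≡1 ⟩
      1                           ∎

  ·2^-halfOrder : ∀ m {x} → k ≡ m + m → 1 ≤ x → x < p → x ·2^ m ≡ p ∸ x
  ·2^-halfOrder m {x} k≡m+m 1≤x x<p = begin
    x * 2 ^ m % p         ≡⟨ [m*[o%n]]%n≡[m*o]%n p x (2 ^ m) ⟨
    x * (2 ^ m % p) % p   ≡⟨ cong (λ z → x * z % p) (2^m%p≡pred[p] m k≡m+m) ⟩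
    x * pred p % p        ≡⟨ [m*pred[n]]%n≡n∸m p 1≤x (<⇒≤ x<p) ⟩
    p ∸ x                 ∎
    where open ≡-Reasoning

module CardioidalStarter {p : ℕ} (p-prime : Prime p) (p≢2 : p ≢ 2) {k : ℕ} (k-ord : IsOrd2 p k)
                         (m : ℕ) (k≡m+m : k ≡ m + m) (m-odd : parity m ≡ 1ℙ) where

  open Doubling p-prime p≢2 k-ord

  k-even : parity k ≡ 0ℙ
  k-even = trans (cong parity k≡m+m) (trans (ℙ.+-homo-+ m m) (ℙ.p+p≡0ℙ (parity m)))

  colour-·2^-odd : ∀ {x} s → parity s ≡ 1ℙ → 1 ≤ x → x < p →
                   colour (x ·2^ s) ≡ colour x ℙ.⁻¹
  colour-·2^-odd {x} s s-odd 1≤x x<p = sym (ℙ.⁻¹-selfInverse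
    (subst (λ π → π ℙ.+ colour (x ·2^ s) ≡ colour x) s-odd (colour-·2^ k-even s 1≤x x<p)))

  colourClass : Parity → List ℕ
  colourClass π = filter (λ x → colour x ℙ.≟ π) (nonzero p)

  colourClass! : ∀ π → Unique (colourClass π)
  colourClass! π = Unique.filter⁺ _ (nonzero! p)

  ∈-colourClass⁻ : ∀ {π x} → x ∈ colourClass π → (1 ≤ x × x < p) × colour x ≡ π
  ∈-colourClass⁻ x∈ with ∈-filter⁻ _ x∈
  ... | x∈nonzero , colour≡π = ∈-nonzero⁻ x∈nonzero , colour≡π

  ∈-colourClass⁺ : ∀ {π x} → 1 ≤ x → x < p → colour x ≡ π → x ∈ colourClass π
  ∈-colourClass⁺ 1≤x x<p colour≡π = ∈-filter⁺ _ (∈-nonzero⁺ 1≤x x<p) colour≡π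

  map-·2^-odd : ∀ π s → parity s ≡ 1ℙ →
                map (_·2^ s) (colourClass π) ↭ colourClass (π ℙ.⁻¹)
  map-·2^-odd π s s-odd =
    inverseOn⇒map-↭ (colourClass! π) (colourClass! (π ℙ.⁻¹)) ·2^s∈ ·2^s′∈
      (λ x∈ → ·2^-inverseʳ s (proj₂ (proj₁ (∈-colourClass⁻ x∈))))
      (λ y∈ → ·2^-inverseˡ s (proj₂ (proj₁ (∈-colourClass⁻ y∈))))
    where
    open ≡-Reasoning
    s′ = s * pred k
    ·2^s∈ : ∀ {x} → x ∈ colourClass π → x ·2^ s ∈ colourClass (π ℙ.⁻¹)
    ·2^s∈ {x} x∈ with ∈-colourClass⁻ x∈
    ... | (1≤x , x<p) , colour≡π = ∈-colourClass⁺ (·2^-positive s 1≤x x<p) (·2^-< x s)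
      (trans (colour-·2^-odd s s-odd 1≤x x<p) (cong ℙ._⁻¹ colour≡π))
    ·2^s′∈ : ∀ {y} → y ∈ colourClass (π ℙ.⁻¹) → y ·2^ s′ ∈ colourClass π
    ·2^s′∈ {y} y∈ with ∈-colourClass⁻ y∈
    ... | (1≤y , y<p) , colour≡π⁻¹ = ∈-colourClass⁺ 1≤x x<p (ℙ.⁻¹-injective (begin
      colour x ℙ.⁻¹        ≡⟨ colour-·2^-odd s s-odd 1≤x x<p ⟨
      colour (x ·2^ s)     ≡⟨ cong colour (·2^-inverseˡ s y<p) ⟩
      colour y             ≡⟨ colour≡π⁻¹ ⟩
      π ℙ.⁻¹               ∎))
      where
      x = y ·2^ s′
      1≤x = ·2^-positive s′ 1≤y y<p
      x<p = ·2^-< y s′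

  I : List ℕ
  I = colourClass 0ℙ

  2i : ℕ → ℕ
  2i i = modN p (2 * i)

  pairs : List Pair
  pairs = map (λ i → i , 2i i) I

  pairs-cardioidal : All (CardioidalPair p) pairs
  pairs-cardioidal = All.map⁺ (All.tabulate λ i∈ →
    let (1≤i , i<p) , _ = ∈-colourClass⁻ i∈ in _ , 1≤i , i<p , inj₁ (refl , refl))

  pairs-elems : concatMap elems pairs ↭ nonzero p
  pairs-elems = begin
    concatMap elems pairs               ≡⟨ cong concat (map-∘ I) ⟨
    concatMap (λ i → i ∷ 2i i ∷ []) I   ↭⟨ concatMap-pair-↭ id 2i I ⟩
    map id I ++ map 2i I                ≡⟨ cong₂ _++_ (map-id I) (map-cong 2i≡i·2^1 I) ⟩
    I ++ map (_·2^ 1) I                 ↭⟨ ++⁺ˡ I (map-·2^-odd 0ℙ 1 refl) ⟩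
    I ++ colourClass 1ℙ                 ↭⟨ ↭-filter-parity colour (nonzero p) ⟨
    nonzero p                           ∎
    where
    open PermutationReasoning
    2i≡i·2^1 : ∀ i → 2i i ≡ i ·2^ 1
    2i≡i·2^1 i = trans (modN≡% p (2 * i)) (cong (_% p) (*-comm 2 i))

  pairs-diffs : concatMap (diffs p) pairs ↭ nonzero p
  pairs-diffs = begin
    concatMap (diffs p) pairs
      ≡⟨ cong concat (map-∘ I) ⟨
    concatMap (λ i → subN p i (2i i) ∷ subN p (2i i) i ∷ []) I
      ↭⟨ concatMap-pair-↭ _ _ I ⟩
    map (λ i → subN p i (2i i)) I ++ map (λ i → subN p (2i i) i) I
      ≡⟨ cong₂ _++_ (map-cong-local (All.tabulate i-2i≡i·2^m)) (map-id-local (All.tabulate 2i-i≡i)) ⟩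
    map (_·2^ m) I ++ I
      ↭⟨ ++⁺ʳ I (map-·2^-odd 0ℙ m m-odd) ⟩
    colourClass 1ℙ ++ I
      ↭⟨ ++-comm (colourClass 1ℙ) I ⟩
    I ++ colourClass 1ℙ
      ↭⟨ ↭-filter-parity colour (nonzero p) ⟨
    nonzero p
      ∎
    where
    open PermutationReasoning
    i-2i≡i·2^m : ∀ {i} → i ∈ I → subN p i (2i i) ≡ i ·2^ m
    i-2i≡i·2^m i∈ with ∈-colourClass⁻ i∈
    ... | (1≤i , i<p) , _ =
      trans (subN[m,2m]≡n∸m p 1≤i i<p) (sym (·2^-halfOrder m k≡m+m 1≤i i<p))
    2i-i≡i : ∀ {i} → i ∈ I → subN p (2i i) i ≡ i
    2i-i≡i i∈ = subN[2m,m]≡m p (proj₂ (proj₁ (∈-colourClass⁻ i∈)))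

corollary3 : ∀ n → C₂ n → ∃[ ps ] IsCardioidalStarter n ps
corollary3 n (n-prime , n≢2 , k , k-ord , k%4≡2) with m%4≡2⇒twice-odd k%4≡2
... | m , k≡m+m , m-odd = pairs , (pairs-elems , pairs-diffs) , pairs-cardioidal
  where open CardioidalStarter n-prime n≢2 k-ord m k≡m+m m-odd
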